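{- Let $n,d$ be natural numbers, let $A:[n]^{2d+1}\to\mathbb{F}$ be a tensor, and let $f_1,\dots,f_n\in\mathbb{F}\langle X\rangle$ be the corresponding polynomials of $A$, i.e. $f_{j_0}=\sum_{j_1,\dots,j_{2d}\in[n]}A(j_0,j_1,\dots,j_{2d})\,S_{2d}(x_{j_1},\dots,x_{j_{2d}})$ for $j_0\in[n]$. Then $Q_{S_{2d}}(f_1,\dots,f_n)\le \mathrm{rank}(A)$.
   Context: $\mathbb{F}$ is a field of characteristic $0$ and $\mathbb{F}\langle X\rangle$ is the free associative algebra of non-commutative polynomials over $\mathbb{F}$ in variables $X=\{x_1,x_2,\dots\}$. $S_{2d}(y_1,\dots,y_{2d})=\sum_{\sigma\in\mathcal{S}_{2d}}\mathrm{sgn}(\sigma)y_{\sigma(1)}\cdots y_{\sigma(2d)}$ is the standard polynomial. A substitution instance of $S_{2d}$ is $S_{2d}(h_1,\dots,h_{2d})$, $h_i\in\mathbb{F}\langle X\rangle$; $Q_{S_{2d}}(f_1,\dots,f_n)$ is the smallest $k$ such that there exist substitution instances $g_1,\dots,g_k$ of $S_{2d}$ with $f_i\in\langle g_1,\dots,g_k\rangle$ (two-sided ideal) for all $i\in[n]$. A tensor $T:[n]^r\to\mathbb{F}$ is simple if $T(i_1,\dots,i_r)=a_1(i_1)\cdots a_r(i_r)$ for some vectors $a_1,\dots,a_r:[n]\to\mathbb{F}$; $\mathrm{rank}(A)$ is the minimal $k$ such that $A$ is a sum of $k$ simple tensors. -}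

module Defs where

open import Level using (Level; _⊔_)
open import Algebra.Bundles using (CommutativeRing)
open import Data.Nat as ℕ using (ℕ; zero; suc)
open import Data.Nat.Properties as ℕP using ()
open import Data.Fin as Fin using (Fin; toℕ)
open import Data.Fin.Properties as FinP using ()
open import Data.List as List using (List; []; _∷_; _++_; map; concatMap; filter; length; foldr; allFin)
open import Data.List.Properties using (≡-dec)
open import Data.Product using (Σ; ∃; _×_; _,_)
open import Relation.Nullary using (¬_; yes; no)
open import Relation.Binary.PropositionalEquality using (_≡_)

record Field (c ℓ : Level) : Set (Level.suc (c ⊔ ℓ)) where
  field
    commutativeRing : CommutativeRing c ℓ
  open CommutativeRing commutativeRing public
  field
    0≉1     : ¬ (0# ≈ 1#)
    inverse : ∀ x → ¬ (x ≈ 0#) → Σ Carrier λ y → (x * y) ≈ 1#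

module FieldTheory {c ℓ : Level} (F : Field c ℓ) where
  open Field F

  ι : ℕ → Carrier
  ι zero    = 0#
  ι (suc m) = 1# + ι m

  CharZero : Set ℓ
  CharZero = ∀ m → ¬ (ι (suc m) ≈ 0#)

  ΣF : (m : ℕ) → (Fin m → Carrier) → Carrier
  ΣF zero    f = 0#
  ΣF (suc m) f = f Fin.zero + ΣF m (λ i → f (Fin.suc i))

  ΠF : (m : ℕ) → (Fin m → Carrier) → Carrier
  ΠF zero    f = 1#
  ΠF (suc m) f = f Fin.zero * ΠF m (λ i → f (Fin.suc i))

  -- The free associative algebra F⟨X⟩, X = {x₀, x₁, x₂, …} indexed by ℕ.
  -- A word (monomial) is a list of variable indices; a polynomial is a
  -- formal finite linear combination of words, i.e. a list of
  -- (coefficient, word) pairs, considered up to equality of all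
  -- coefficients (_≈ₚ_).

  Word : Set
  Word = List ℕ

  Poly : Set c
  Poly = List (Carrier × Word)

  coeff : Word → Poly → Carrier
  coeff w []            = 0#
  coeff w ((a , u) ∷ p) with ≡-dec ℕ._≟_ u w
  ... | yes _ = a + coeff w p
  ... | no  _ = coeff w p

  infix 4 _≈ₚ_
  _≈ₚ_ : Poly → Poly → Set ℓ
  p ≈ₚ q = ∀ w → coeff w p ≈ coeff w q

  0ₚ : Poly
  0ₚ = []

  1ₚ : Poly
  1ₚ = (1# , []) ∷ []

  var : ℕ → Poly
  var j = (1# , j ∷ []) ∷ []

  infixl 6 _+ₚ_
  _+ₚ_ : Poly → Poly → Poly
  p +ₚ q = p ++ q

  infixl 7 _*ₚ_
  _*ₚ_ : Poly → Poly → Poly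
  p *ₚ q = concatMap (λ { (a , u) → map (λ { (b , v) → (a * b , u ++ v) }) q }) p

  infixl 7 _·ₚ_
  _·ₚ_ : Carrier → Poly → Poly
  a ·ₚ p = map (λ { (b , v) → (a * b , v) }) p

  ΣₚL : List Poly → Poly
  ΣₚL = foldr _+ₚ_ 0ₚ

  ΠₚL : List Poly → Poly
  ΠₚL = foldr _*ₚ_ 1ₚ

  -- Permutations of [m] (as lists of distinct elements of Fin m, listing
  -- σ(1), …, σ(m)) and their signs.

  insertions : {A : Set} → A → List A → List (List A)
  insertions x []       = (x ∷ []) ∷ []
  insertions x (y ∷ ys) = (x ∷ y ∷ ys) ∷ map (y ∷_) (insertions x ys)

  permutations : {A : Set} → List A → List (List A)
  permutations []       = [] ∷ []
  permutations (x ∷ xs) = concatMap (insertions x) (permutations xs)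

  Perms : (m : ℕ) → List (List (Fin m))
  Perms m = permutations (allFin m)

  inversions : {m : ℕ} → List (Fin m) → ℕ
  inversions []       = 0
  inversions (x ∷ xs) = length (filter (λ y → y Fin.<? x) xs) ℕ.+ inversions xs

  sgnPar : ℕ → Carrier
  sgnPar zero          = 1#
  sgnPar (suc zero)    = - 1#
  sgnPar (suc (suc k)) = sgnPar k

  sgn : {m : ℕ} → List (Fin m) → Carrier
  sgn σ = sgnPar (inversions σ)

  S : (m : ℕ) → (Fin m → Poly) → Poly
  S m h = ΣₚL (map (λ σ → sgn σ ·ₚ ΠₚL (map h σ)) (Perms m))

  IsSubstInstance : (d : ℕ) → Poly → Set (c ⊔ ℓ)
  IsSubstInstance d g = Σ (Fin (2 ℕ.* d) → Poly) λ h → g ≈ₚ S (2 ℕ.* d) h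

  InIdeal : {k : ℕ} → (Fin k → Poly) → Poly → Set (c ⊔ ℓ)
  InIdeal {k} g f =
    Σ (List (Poly × Fin k × Poly)) λ ts →
      f ≈ₚ ΣₚL (map (λ { (a , i , b) → a *ₚ g i *ₚ b }) ts)

  -- Q_{S_{2d}}(f₁,…,f_n) ≤ k : there are k substitution instances of
  -- S_{2d} whose two-sided ideal contains every f_i.
  -- (Q is the least such k, so "Q ≤ k" is exactly this predicate, which
  -- is upward closed since instances may repeat.)
  Q≤ : (d : ℕ) {n : ℕ} → (Fin n → Poly) → ℕ → Set (c ⊔ ℓ)
  Q≤ d {n} f k =
    Σ (Fin k → Poly) λ g →
      (∀ l → IsSubstInstance d (g l)) × (∀ i → InIdeal g (f i))

  Tensor : (n r : ℕ) → Set c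
  Tensor n r = (Fin r → Fin n) → Carrier

  IsSimple : {n r : ℕ} → Tensor n r → Set (c ⊔ ℓ)
  IsSimple {n} {r} T =
    Σ (Fin r → Fin n → Carrier) λ a →
      ∀ (i : Fin r → Fin n) → T i ≈ ΠF r (λ t → a t (i t))

  -- rank(A) ≤ k : A is a sum of k simple tensors
  -- (rank is the least such k, so "rank ≤ k" is exactly this predicate).
  Rank≤ : {n r : ℕ} → Tensor n r → ℕ → Set (c ⊔ ℓ)
  Rank≤ {n} {r} A k =
    Σ (Fin k → Tensor n r) λ T →
      (∀ l → IsSimple (T l)) × (∀ i → A i ≈ ΣF k (λ l → T l i))

  -- The polynomials corresponding to a tensor A : [n]^{2d+1} → F:
  --   f_{j₀} = Σ_{j₁,…,j_{2d} ∈ [n]} A(j₀,j₁,…,j_{2d}) S_{2d}(x_{j₁},…,x_{j_{2d}}),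
  -- with x_j (j ∈ [n]) the variable indexed by toℕ j.

  cons : {m n : ℕ} → Fin n → (Fin m → Fin n) → (Fin (suc m) → Fin n)
  cons j g Fin.zero    = j
  cons j g (Fin.suc t) = g t

  allFuns : (m n : ℕ) → List (Fin m → Fin n)
  allFuns zero    n = (λ ()) ∷ []
  allFuns (suc m) n =
    concatMap (λ j → map (cons j) (allFuns m n))
              (allFin n)

  tensorPolys : (d n : ℕ) → Tensor n (suc (2 ℕ.* d)) → Fin n → Poly
  tensorPolys d n A j₀ =
    ΣₚL (map (λ js → A (cons j₀ js) ·ₚ S (2 ℕ.* d) (λ t → var (toℕ (js t))))
             (allFuns (2 ℕ.* d) n))

-- Write A = Σ_{l<k} a_l⁰ ⊗ a_l¹ ⊗ ⋯ ⊗ a_l^{2d} and put h_{l,t} = Σ_j a_l^t(j) x_j.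
-- Because the standard polynomial is multilinear,
--   S_{2d}(h_{l,1},…,h_{l,2d}) = Σ_{j₁…j_{2d}} a_l¹(j₁)⋯a_l^{2d}(j_{2d}) S_{2d}(x_{j₁},…,x_{j_{2d}}),
-- hence f_{j₀} = Σ_l a_l⁰(j₀) · S_{2d}(h_{l,1},…,h_{l,2d}): the k substitution
-- instances g_l = S_{2d}(h_{l,1},…,h_{l,2d}) generate an ideal containing every f_{j₀}.
--
-- Polynomials are lists of terms compared coefficientwise, so everything is proved
-- on coefficients.
module Submission where

open import Defs
open import Level using (Level)
open import Data.Nat as ℕ using (ℕ; zero; suc)
open import Data.Fin as Fin using (Fin; toℕ)
import Data.Fin.Properties as FinP
import Data.Nat.Properties as ℕP
open import Data.List using (List; []; _∷_; _++_; map; concatMap; length; allFin; tabulate; zip; filter)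
open import Data.List.Properties
  using (≡-dec; ++-identityʳ; ∷-injectiveˡ; ∷-injectiveʳ; filter-accept; filter-reject; filter-none)
open import Data.List.Relation.Unary.All as All using (All; []; _∷_)
open import Data.List.Relation.Unary.All.Properties using (concat⁺; map⁺)
open import Data.List.Relation.Unary.Any using (here; there)
open import Data.List.Relation.Unary.AllPairs using (_∷_)
open import Data.List.Relation.Unary.Unique.Propositional using (Unique)
open import Data.List.Relation.Unary.Unique.Propositional.Properties using (allFin⁺)
open import Data.List.Membership.Propositional using (_∈_)
open import Data.List.Membership.Propositional.Properties using (∈-allFin)
open import Data.List.Relation.Binary.Permutation.Propositional as Perm using (_↭_; ↭-sym; ↭⇒↭ₛ)
open import Data.List.Relation.Binary.Permutation.Propositional.Properties using (∈-resp-↭)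
import Data.List.Relation.Binary.Permutation.Setoid.Properties as PermSetoid
open import Data.Product using (Σ; _×_; _,_; proj₁; proj₂)
open import Relation.Nullary using (¬_; Dec; yes; no; contradiction)
open import Relation.Unary using (Decidable)
import Algebra.Properties.CommutativeSemigroup as CommSemigroupProps
import Relation.Binary.PropositionalEquality as P

module Proof {c ℓ : Level} (F : Field c ℓ) where
  open Field F
  open FieldTheory F
  open import Relation.Binary.Reasoning.Setoid setoid
  open CommSemigroupProps +-commutativeSemigroup using () renaming (interchange to +-interchange)
  open CommSemigroupProps *-commutativeSemigroup using ()
    renaming (interchange to *-interchange; x∙yz≈y∙xz to *-leftSwap)

  ∑ : ∀ {a} {A : Set a} → (A → Carrier) → List A → Carrier
  ∑ f []       = 0#
  ∑ f (x ∷ xs) = f x + ∑ f xs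

  module _ {a} {A : Set a} where

    ∑-congᴬ : ∀ {f g : A → Carrier} {xs} → All (λ x → f x ≈ g x) xs → ∑ f xs ≈ ∑ g xs
    ∑-congᴬ []       = refl
    ∑-congᴬ (e ∷ es) = +-cong e (∑-congᴬ es)

    ∑-cong : ∀ {f g : A → Carrier} xs → (∀ x → f x ≈ g x) → ∑ f xs ≈ ∑ g xs
    ∑-cong []       e = refl
    ∑-cong (x ∷ xs) e = +-cong (e x) (∑-cong xs e)

    ∑-zero : ∀ (xs : List A) → ∑ (λ _ → 0#) xs ≈ 0#
    ∑-zero []       = refl
    ∑-zero (x ∷ xs) = trans (+-identityˡ _) (∑-zero xs)

    ∑-++ : ∀ (f : A → Carrier) xs ys → ∑ f (xs ++ ys) ≈ ∑ f xs + ∑ f ys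
    ∑-++ f []       ys = sym (+-identityˡ _)
    ∑-++ f (x ∷ xs) ys = trans (+-cong refl (∑-++ f xs ys)) (sym (+-assoc _ _ _))

    ∑-*ˡ : ∀ (f : A → Carrier) a xs → ∑ (λ x → a * f x) xs ≈ a * ∑ f xs
    ∑-*ˡ f a []       = sym (zeroʳ a)
    ∑-*ˡ f a (x ∷ xs) = trans (+-cong refl (∑-*ˡ f a xs)) (sym (distribˡ a _ _))

    ∑-*ʳ : ∀ (f : A → Carrier) a xs → ∑ (λ x → f x * a) xs ≈ ∑ f xs * a
    ∑-*ʳ f a []       = sym (zeroˡ a)
    ∑-*ʳ f a (x ∷ xs) = trans (+-cong refl (∑-*ʳ f a xs)) (sym (distribʳ a _ _))

    ∑-+ : ∀ (f g : A → Carrier) xs → ∑ (λ x → f x + g x) xs ≈ ∑ f xs + ∑ g xs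
    ∑-+ f g []       = sym (+-identityʳ 0#)
    ∑-+ f g (x ∷ xs) = trans (+-cong refl (∑-+ f g xs)) (+-interchange _ _ _ _)

  ∑-map : ∀ {a b} {A : Set a} {B : Set b} (f : B → Carrier) (g : A → B) xs →
          ∑ f (map g xs) P.≡ ∑ (λ x → f (g x)) xs
  ∑-map f g []       = P.refl
  ∑-map f g (x ∷ xs) = P.cong (f (g x) +_) (∑-map f g xs)

  ∑-concatMap : ∀ {a b} {A : Set a} {B : Set b} (f : B → Carrier) (g : A → List B) xs →
                ∑ f (concatMap g xs) ≈ ∑ (λ x → ∑ f (g x)) xs
  ∑-concatMap f g []       = refl
  ∑-concatMap f g (x ∷ xs) = trans (∑-++ f (g x) _) (+-cong refl (∑-concatMap f g xs))

  ∑-swap : ∀ {a b} {A : Set a} {B : Set b} (f : A → B → Carrier) xs ys →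
           ∑ (λ x → ∑ (f x) ys) xs ≈ ∑ (λ y → ∑ (λ x → f x y) xs) ys
  ∑-swap f []       ys = sym (∑-zero ys)
  ∑-swap f (x ∷ xs) ys =
    trans (+-cong refl (∑-swap f xs ys)) (sym (∑-+ (f x) (λ y → ∑ (λ x → f x y) xs) ys))

  ∑-bilinear : ∀ {a b} {A : Set a} {B : Set b} (c : B → Carrier) (W : B → A → Carrier)
               (s : A → Carrier) xs ys →
               ∑ (λ x → ∑ (λ y → c y * W y x) ys * s x) xs
                 ≈ ∑ (λ y → c y * ∑ (λ x → W y x * s x) xs) ys
  ∑-bilinear c W s xs ys = begin
    ∑ (λ x → ∑ (λ y → c y * W y x) ys * s x) xs
      ≈⟨ ∑-cong xs (λ x → trans (sym (∑-*ʳ _ (s x) ys)) (∑-cong ys (λ y → *-assoc _ _ _))) ⟩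
    ∑ (λ x → ∑ (λ y → c y * (W y x * s x)) ys) xs
      ≈⟨ ∑-swap (λ x y → c y * (W y x * s x)) xs ys ⟩
    ∑ (λ y → ∑ (λ x → c y * (W y x * s x)) xs) ys
      ≈⟨ ∑-cong ys (λ y → ∑-*ˡ _ (c y) xs) ⟩
    ∑ (λ y → c y * ∑ (λ x → W y x * s x) xs) ys ∎

  ∑-tabulate : ∀ {b} {B : Set b} m (f : B → Carrier) (g : Fin m → B) →
               ∑ f (tabulate g) P.≡ ΣF m (λ i → f (g i))
  ∑-tabulate zero    f g = P.refl
  ∑-tabulate (suc m) f g = P.cong (f (g Fin.zero) +_) (∑-tabulate m f (λ i → g (Fin.suc i)))

  ΠF-cong : ∀ m {f g : Fin m → Carrier} → (∀ t → f t ≈ g t) → ΠF m f ≈ ΠF m g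
  ΠF-cong zero    e = refl
  ΠF-cong (suc m) e = *-cong (e Fin.zero) (ΠF-cong m (λ t → e (Fin.suc t)))

  ΠF-one : ∀ m → ΠF m (λ _ → 1#) ≈ 1#
  ΠF-one zero    = refl
  ΠF-one (suc m) = trans (*-identityˡ _) (ΠF-one m)

  ΠF-* : ∀ m (f g : Fin m → Carrier) → ΠF m (λ t → f t * g t) ≈ ΠF m f * ΠF m g
  ΠF-* zero    f g = sym (*-identityˡ 1#)
  ΠF-* (suc m) f g =
    trans (*-cong refl (ΠF-* m (λ t → f (Fin.suc t)) (λ t → g (Fin.suc t)))) (*-interchange _ _ _ _)

  ΠF-focus : ∀ m (t₀ : Fin m) a (K K' : Fin m → Carrier) → K t₀ ≈ a * K' t₀ →
             (∀ t → ¬ t P.≡ t₀ → K t ≈ K' t) → ΠF m K ≈ a * ΠF m K'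
  ΠF-focus (suc m) Fin.zero a K K' at₀ away =
    trans (*-cong at₀ (ΠF-cong m (λ t → away (Fin.suc t) (λ ())))) (*-assoc _ _ _)
  ΠF-focus (suc m) (Fin.suc t₀) a K K' at₀ away =
    trans (*-cong (away Fin.zero (λ ()))
                  (ΠF-focus m t₀ a (λ t → K (Fin.suc t)) (λ t → K' (Fin.suc t)) at₀
                            (λ t t≢t₀ → away (Fin.suc t) (λ e → t≢t₀ (FinP.suc-injective e)))))
          (*-leftSwap _ _ _)

  ∑-allFuns-ΠF : ∀ m n (G : Fin m → Fin n → Carrier) →
                 ∑ (λ js → ΠF m (λ t → G t (js t))) (allFuns m n) ≈ ΠF m (λ t → ∑ (G t) (allFin n))
  ∑-allFuns-ΠF zero    n G = +-identityʳ 1#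
  ∑-allFuns-ΠF (suc m) n G = begin
    ∑ (λ js → ΠF (suc m) (λ t → G t (js t))) (allFuns (suc m) n)
      ≈⟨ ∑-concatMap _ (λ j → map (cons j) (allFuns m n)) (allFin n) ⟩
    ∑ (λ j → ∑ (λ js → ΠF (suc m) (λ t → G t (js t))) (map (cons j) (allFuns m n))) (allFin n)
      ≈⟨ ∑-cong (allFin n) (λ j → reflexive (∑-map _ (cons j) (allFuns m n))) ⟩
    ∑ (λ j → ∑ (λ js → G Fin.zero j * ΠF m (λ t → G (Fin.suc t) (js t))) (allFuns m n)) (allFin n)
      ≈⟨ ∑-cong (allFin n) (λ j → trans (∑-*ˡ _ (G Fin.zero j) (allFuns m n))
                                         (*-cong refl (∑-allFuns-ΠF m n (λ t → G (Fin.suc t))))) ⟩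
    ∑ (λ j → G Fin.zero j * ΠF m (λ t → ∑ (G (Fin.suc t)) (allFin n))) (allFin n)
      ≈⟨ ∑-*ʳ (G Fin.zero) _ (allFin n) ⟩
    ΠF (suc m) (λ t → ∑ (G t) (allFin n)) ∎

  coeff-hit : ∀ {w u} a p → u P.≡ w → coeff w ((a , u) ∷ p) P.≡ a + coeff w p
  coeff-hit {w} {u} a p u≡w with ≡-dec ℕ._≟_ u w
  ... | yes _   = P.refl
  ... | no u≢w = contradiction u≡w u≢w

  coeff-miss : ∀ {w u} a p → ¬ u P.≡ w → coeff w ((a , u) ∷ p) P.≡ coeff w p
  coeff-miss {w} {u} a p u≢w with ≡-dec ℕ._≟_ u w
  ... | yes u≡w = contradiction u≡w u≢w
  ... | no _    = P.refl

  coeff-++ : ∀ w p q → coeff w (p ++ q) ≈ coeff w p + coeff w q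
  coeff-++ w []            q = sym (+-identityˡ _)
  coeff-++ w ((a , u) ∷ p) q with ≡-dec ℕ._≟_ u w
  ... | yes _ = trans (+-cong refl (coeff-++ w p q)) (sym (+-assoc _ _ _))
  ... | no _  = coeff-++ w p q

  coeff-ΣₚL : ∀ {a} {A : Set a} w (p : A → Poly) xs →
              coeff w (ΣₚL (map p xs)) ≈ ∑ (λ x → coeff w (p x)) xs
  coeff-ΣₚL w p []       = refl
  coeff-ΣₚL w p (x ∷ xs) = trans (coeff-++ w (p x) _) (+-cong refl (coeff-ΣₚL w p xs))

  coeff-·ₚ : ∀ w a p → coeff w (a ·ₚ p) ≈ a * coeff w p
  coeff-·ₚ w a []            = sym (zeroʳ a)
  coeff-·ₚ w a ((b , v) ∷ p) with ≡-dec ℕ._≟_ v w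
  ... | yes _ = trans (+-cong refl (coeff-·ₚ w a p)) (sym (distribˡ a b _))
  ... | no _  = coeff-·ₚ w a p

  constₚ : Carrier → Poly
  constₚ a = (a , []) ∷ []

  coeff-const* : ∀ w a p → coeff w (constₚ a *ₚ p) ≈ a * coeff w p
  coeff-const* w a []            = sym (zeroʳ a)
  coeff-const* w a ((b , v) ∷ p) with ≡-dec ℕ._≟_ v w
  ... | yes _ = trans (+-cong refl (coeff-const* w a p)) (sym (distribˡ a b _))
  ... | no _  = coeff-const* w a p

  coeff-*1ₚ : ∀ w p → coeff w (p *ₚ 1ₚ) ≈ coeff w p
  coeff-*1ₚ w []            = refl
  coeff-*1ₚ w ((a , u) ∷ p) rewrite ++-identityʳ u with ≡-dec ℕ._≟_ u w
  ... | yes _ = +-cong (*-identityʳ a) (coeff-*1ₚ w p)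
  ... | no _  = coeff-*1ₚ w p

  coeff-∷*ₚ : ∀ w t p R → coeff w ((t ∷ p) *ₚ R) ≈ coeff w ((t ∷ []) *ₚ R) + coeff w (p *ₚ R)
  coeff-∷*ₚ w t p R =
    trans (coeff-++ w (map _ R) (p *ₚ R))
          (+-cong (sym (trans (coeff-++ w (map _ R) []) (+-identityʳ _))) refl)

  δ : ℕ → ℕ → Carrier
  δ y x with y ℕ.≟ x
  ... | yes _ = 1#
  ... | no _  = 0#

  δ-hit : ∀ {y x} → y P.≡ x → δ y x ≈ 1#
  δ-hit {y} {x} y≡x with y ℕ.≟ x
  ... | yes _   = refl
  ... | no y≢x = contradiction y≡x y≢x

  δ-miss : ∀ {y x} → ¬ y P.≡ x → δ y x ≈ 0#
  δ-miss {y} {x} y≢x with y ℕ.≟ x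
  ... | yes y≡x = contradiction y≡x y≢x
  ... | no _    = refl

  monoₚ : Carrier → ℕ → Poly
  monoₚ a y = (a , y ∷ []) ∷ []

  coeff-mono*-[] : ∀ a y R → coeff [] (monoₚ a y *ₚ R) ≈ 0#
  coeff-mono*-[] a y []            = refl
  coeff-mono*-[] a y ((b , v) ∷ R) =
    trans (reflexive (coeff-miss {[]} {y ∷ v} (a * b) (monoₚ a y *ₚ R) (λ ()))) (coeff-mono*-[] a y R)

  coeff-mono*-∷ : ∀ a y x w R → coeff (x ∷ w) (monoₚ a y *ₚ R) ≈ (a * δ y x) * coeff w R
  coeff-mono*-∷ a y x w []            = sym (zeroʳ _)
  coeff-mono*-∷ a y x w ((b , v) ∷ R) = by-cases (y ℕ.≟ x) (≡-dec ℕ._≟_ v w)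
    where
    rest : Poly
    rest = monoₚ a y *ₚ R
    induction : coeff (x ∷ w) rest ≈ (a * δ y x) * coeff w R
    induction = coeff-mono*-∷ a y x w R
    by-cases : Dec (y P.≡ x) → Dec (v P.≡ w) →
               coeff (x ∷ w) ((a * b , y ∷ v) ∷ rest) ≈ (a * δ y x) * coeff w ((b , v) ∷ R)
    by-cases (yes y≡x) (yes v≡w) = begin
      coeff (x ∷ w) ((a * b , y ∷ v) ∷ rest)      ≡⟨ coeff-hit (a * b) rest (P.cong₂ _∷_ y≡x v≡w) ⟩
      a * b + coeff (x ∷ w) rest                  ≈⟨ +-cong (*-cong (sym a·δ≈a) refl) induction ⟩
      (a * δ y x) * b + (a * δ y x) * coeff w R   ≈⟨ sym (distribˡ _ _ _) ⟩
      (a * δ y x) * (b + coeff w R)               ≡⟨ P.cong ((a * δ y x) *_) (P.sym (coeff-hit b R v≡w)) ⟩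
      (a * δ y x) * coeff w ((b , v) ∷ R)         ∎
      where a·δ≈a = trans (*-cong refl (δ-hit y≡x)) (*-identityʳ a)
    by-cases (yes y≡x) (no v≢w) =
      trans (reflexive (coeff-miss {x ∷ w} {y ∷ v} (a * b) rest (λ e → v≢w (∷-injectiveʳ e))))
            (trans induction (*-cong refl (reflexive (P.sym (coeff-miss b R v≢w)))))
    by-cases (no y≢x) _ =
      trans (reflexive (coeff-miss {x ∷ w} {y ∷ v} (a * b) rest (λ e → y≢x (∷-injectiveˡ e))))
            (trans induction (trans (vanishes _) (sym (vanishes _))))
      where vanishes : ∀ z → (a * δ y x) * z ≈ 0#
            vanishes z = trans (*-cong (trans (*-cong refl (δ-miss y≢x)) (zeroʳ a)) refl) (zeroˡ z)

  lin : ∀ {n} → List (Fin n) → (Fin n → Carrier) → Poly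
  lin L b = map (λ j → (b j , toℕ j ∷ [])) L

  linCoeff : ∀ {n} → List (Fin n) → (Fin n → Carrier) → ℕ → Carrier
  linCoeff L b x = ∑ (λ j → b j * δ (toℕ j) x) L

  linCoeff-var : ∀ {n} (j : Fin n) x → linCoeff (j ∷ []) (λ _ → 1#) x ≈ δ (toℕ j) x
  linCoeff-var j x = trans (+-identityʳ _) (*-identityˡ _)

  coeff-lin*-[] : ∀ {n} (L : List (Fin n)) b R → coeff [] (lin L b *ₚ R) ≈ 0#
  coeff-lin*-[] []      b R = refl
  coeff-lin*-[] (j ∷ L) b R =
    trans (coeff-∷*ₚ [] _ (lin L b) R)
          (trans (+-cong (coeff-mono*-[] (b j) (toℕ j) R) (coeff-lin*-[] L b R)) (+-identityʳ 0#))

  coeff-lin*-∷ : ∀ {n} (L : List (Fin n)) b R x w →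
                 coeff (x ∷ w) (lin L b *ₚ R) ≈ linCoeff L b x * coeff w R
  coeff-lin*-∷ []      b R x w = sym (zeroˡ _)
  coeff-lin*-∷ (j ∷ L) b R x w =
    trans (coeff-∷*ₚ (x ∷ w) _ (lin L b) R)
          (trans (+-cong (coeff-mono*-∷ (b j) (toℕ j) x w R) (coeff-lin*-∷ L b R x w))
                 (sym (distribʳ _ _ _)))

  alignedProd : ∀ {m} → (Fin m → ℕ → Carrier) → List (Fin m) → Word → Carrier
  alignedProd G []      []      = 1#
  alignedProd G []      (_ ∷ _) = 0#
  alignedProd G (_ ∷ _) []      = 0#
  alignedProd G (t ∷ σ) (x ∷ w) = G t x * alignedProd G σ w

  alignedProd-mismatch : ∀ {m} (G : Fin m → ℕ → Carrier) σ w →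
                         ¬ length σ P.≡ length w → alignedProd G σ w ≈ 0#
  alignedProd-mismatch G []      []      ne = contradiction P.refl ne
  alignedProd-mismatch G []      (x ∷ w) ne = refl
  alignedProd-mismatch G (t ∷ σ) []      ne = refl
  alignedProd-mismatch G (t ∷ σ) (x ∷ w) ne =
    trans (*-cong refl (alignedProd-mismatch G σ w (λ e → ne (P.cong suc e)))) (zeroʳ _)

  coeff-ΠₚL-lin : ∀ {m n} (L : Fin m → List (Fin n)) (b : Fin m → Fin n → Carrier) σ w →
                  coeff w (ΠₚL (map (λ t → lin (L t) (b t)) σ))
                    ≈ alignedProd (λ t → linCoeff (L t) (b t)) σ w
  coeff-ΠₚL-lin L b []      []      = +-identityʳ 1#
  coeff-ΠₚL-lin L b []      (x ∷ w) = reflexive (coeff-miss {x ∷ w} {[]} 1# [] (λ ()))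
  coeff-ΠₚL-lin L b (t ∷ σ) []      = coeff-lin*-[] (L t) (b t) _
  coeff-ΠₚL-lin L b (t ∷ σ) (x ∷ w) =
    trans (coeff-lin*-∷ (L t) (b t) _ x w) (*-cong refl (coeff-ΠₚL-lin L b σ w))

  prodPairs : ∀ {m} → (Fin m → ℕ → Carrier) → List (Fin m × ℕ) → Carrier
  prodPairs φ []             = 1#
  prodPairs φ ((t , x) ∷ ps) = φ t x * prodPairs φ ps

  alignedProd-zip : ∀ {m} (G : Fin m → ℕ → Carrier) σ w → length σ P.≡ length w →
                    alignedProd G σ w P.≡ prodPairs G (zip σ w)
  alignedProd-zip G []      []      e = P.refl
  alignedProd-zip G (t ∷ σ) (x ∷ w) e = P.cong (G t x *_) (alignedProd-zip G σ w (ℕP.suc-injective e))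

  indexIs? : ∀ {m} (t : Fin m) → Decidable (λ (p : Fin m × ℕ) → proj₁ p P.≡ t)
  indexIs? t p = proj₁ p Fin.≟ t

  sel : ∀ {m} → Fin m → List (Fin m × ℕ) → List (Fin m × ℕ)
  sel t = filter (indexIs? t)

  regroup : ∀ {m} (φ : Fin m → ℕ → Carrier) ps → prodPairs φ ps ≈ ΠF m (λ t → prodPairs φ (sel t ps))
  regroup {m} φ []               = sym (ΠF-one m)
  regroup {m} φ ((t₀ , x) ∷ ps) =
    trans (*-cong refl (regroup φ ps))
          (sym (ΠF-focus m t₀ (φ t₀ x) _ _
                  (reflexive (P.cong (prodPairs φ) (filter-accept (indexIs? t₀) P.refl)))
                  (λ t t≢t₀ → reflexive (P.cong (prodPairs φ)
                                 (filter-reject (indexIs? t) (λ e → t≢t₀ (P.sym e)))))))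

  zip-All : ∀ {m p} {Q : Fin m → Set p} {σ} (w : Word) → All Q σ → All (λ q → Q (proj₁ q)) (zip σ w)
  zip-All w       []         = []
  zip-All []      (qt ∷ qσ) = []
  zip-All (x ∷ w) (qt ∷ qσ) = qt ∷ zip-All w qσ

  sel-single : ∀ {m} {t : Fin m} σ w → Unique σ → t ∈ σ → length σ P.≡ length w →
               Σ ℕ λ x → sel t (zip σ w) P.≡ (t , x) ∷ []
  sel-single {t = t} (t ∷ σ) (x ∷ w) (t∉σ ∷ _) (here P.refl) _ =
    x , P.trans (filter-accept (indexIs? t) P.refl)
                (P.cong ((t , x) ∷_) (filter-none (indexIs? t)
                   (zip-All w (All.map (λ t≢y y≡t → t≢y (P.sym y≡t)) t∉σ))))
  sel-single {t = t} (t' ∷ σ) (x ∷ w) (t'∉σ ∷ uniq) (there t∈σ) e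
    with sel-single σ w uniq t∈σ (ℕP.suc-injective e)
  ... | y , single = y , P.trans (filter-reject (indexIs? t) (All.lookup t'∉σ t∈σ)) single

  Enumerates : ∀ {m} → List (Fin m) → Set
  Enumerates {m} σ = Unique σ × (∀ t → t ∈ σ)

  -- Along an enumeration σ, a product over positions is a product over Fin m:
  -- Π_p φ(σ_p, w_p) = Π_t φ(t, X t), where X t is the letter of w at t's position.
  enumeration-regroup : ∀ {m} {σ : List (Fin m)} {w} → Enumerates σ → length σ P.≡ length w →
                        Σ (Fin m → ℕ) λ X → ∀ φ → alignedProd φ σ w ≈ ΠF m (λ t → φ t (X t))
  enumeration-regroup {m} {σ} {w} (uniq , complete) e = X , regrouped
    where
    single : ∀ t → Σ ℕ λ x → sel t (zip σ w) P.≡ (t , x) ∷ []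
    single t = sel-single σ w uniq (complete t) e
    X : Fin m → ℕ
    X t = proj₁ (single t)
    regrouped : ∀ φ → alignedProd φ σ w ≈ ΠF m (λ t → φ t (X t))
    regrouped φ = begin
      alignedProd φ σ w                           ≡⟨ alignedProd-zip φ σ w e ⟩
      prodPairs φ (zip σ w)                       ≈⟨ regroup φ (zip σ w) ⟩
      ΠF m (λ t → prodPairs φ (sel t (zip σ w)))  ≈⟨ ΠF-cong m (λ t → trans
                                                       (reflexive (P.cong (prodPairs φ) (proj₂ (single t))))
                                                       (*-identityʳ _)) ⟩
      ΠF m (λ t → φ t (X t))                      ∎

  insertions-↭ : ∀ {A : Set} (x : A) ys → All (_↭ x ∷ ys) (insertions x ys)
  insertions-↭ x []       = Perm.refl ∷ []
  insertions-↭ x (y ∷ ys) =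
    Perm.refl ∷ map⁺ (All.map (λ ρ↭ → Perm.trans (Perm.prep y ρ↭) (Perm.swap y x Perm.refl))
                              (insertions-↭ x ys))

  permutations-↭ : ∀ {A : Set} (xs : List A) → All (_↭ xs) (permutations xs)
  permutations-↭ []       = Perm.refl ∷ []
  permutations-↭ (x ∷ xs) =
    concat⁺ (map⁺ (All.map (λ {σ} σ↭ → All.map (λ ρ↭ → Perm.trans ρ↭ (Perm.prep x σ↭))
                                                (insertions-↭ x σ))
                           (permutations-↭ xs)))

  Perms-enumerate : ∀ m → All Enumerates (Perms m)
  Perms-enumerate m = All.map enumerates (permutations-↭ (allFin m))
    where
    open PermSetoid (P.setoid (Fin m)) using (Unique-resp-↭)
    enumerates : ∀ {σ} → σ ↭ allFin m → Enumerates σ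
    enumerates σ↭ = Unique-resp-↭ (↭⇒↭ₛ (↭-sym σ↭)) (allFin⁺ m)
                  , λ t → ∈-resp-↭ (↭-sym σ↭) (∈-allFin t)

  coeff-S : ∀ m (h : Fin m → Poly) w →
            coeff w (S m h) ≈ ∑ (λ σ → sgn σ * coeff w (ΠₚL (map h σ))) (Perms m)
  coeff-S m h w =
    trans (coeff-ΣₚL w _ (Perms m)) (∑-cong (Perms m) (λ σ → coeff-·ₚ w (sgn σ) (ΠₚL (map h σ))))

  -- Multilinearity of the standard polynomial: for linear forms
  -- h_t = Σ_j β_t(j) x_j,  S_m(h) = Σ_js (Π_t β_t(js t)) S_m(x_{js 1}, …, x_{js m}).
  module Multilinear {m n : ℕ} (β : Fin m → Fin n → Carrier) where

    weight : (Fin m → Fin n) → Carrier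
    weight js = ΠF m (λ t → β t (js t))

    form : Fin m → Poly
    form t = lin (allFin n) (β t)

    monomial : (Fin m → Fin n) → Fin m → Poly
    monomial js t = var (toℕ (js t))

    monomialCoeff : (Fin m → Fin n) → Fin m → ℕ → Carrier
    monomialCoeff js t = linCoeff (js t ∷ []) (λ _ → 1#)

    formCoeff : Fin m → ℕ → Carrier
    formCoeff t = linCoeff (allFin n) (β t)

    coeff-monomials : ∀ js σ w → coeff w (ΠₚL (map (monomial js) σ)) ≈ alignedProd (monomialCoeff js) σ w
    coeff-monomials js = coeff-ΠₚL-lin (λ t → js t ∷ []) (λ _ _ → 1#)

    coeff-forms : ∀ σ w → coeff w (ΠₚL (map form σ)) ≈ alignedProd formCoeff σ w
    coeff-forms = coeff-ΠₚL-lin (λ _ → allFin n) β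

    product-expansion : ∀ σ → Enumerates σ → ∀ w →
      ∑ (λ js → weight js * coeff w (ΠₚL (map (monomial js) σ))) (allFuns m n) ≈ coeff w (ΠₚL (map form σ))
    product-expansion σ enum w with length σ ℕ.≟ length w
    ... | no mismatch =
      trans (∑-cong (allFuns m n) (λ js → trans (*-cong refl (trans (coeff-monomials js σ w)
                                                     (alignedProd-mismatch _ σ w mismatch)))
                                                 (zeroʳ _)))
            (trans (∑-zero (allFuns m n))
                   (sym (trans (coeff-forms σ w) (alignedProd-mismatch _ σ w mismatch))))
    ... | yes e with enumeration-regroup enum e
    ...   | X , regrouped = begin
      ∑ (λ js → weight js * coeff w (ΠₚL (map (monomial js) σ))) (allFuns m n)
        ≈⟨ ∑-cong (allFuns m n) (λ js → *-cong refl (trans (coeff-monomials js σ w)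
                                                           (regrouped (monomialCoeff js)))) ⟩
      ∑ (λ js → weight js * ΠF m (λ t → monomialCoeff js t (X t))) (allFuns m n)
        ≈⟨ ∑-cong (allFuns m n) (λ js → trans (sym (ΠF-* m _ _))
                                (ΠF-cong m (λ t → *-cong refl (linCoeff-var (js t) (X t))))) ⟩
      ∑ (λ js → ΠF m (λ t → β t (js t) * δ (toℕ (js t)) (X t))) (allFuns m n)
        ≈⟨ ∑-allFuns-ΠF m n (λ t j → β t j * δ (toℕ j) (X t)) ⟩
      ΠF m (λ t → formCoeff t (X t))
        ≈⟨ sym (regrouped formCoeff) ⟩
      alignedProd formCoeff σ w
        ≈⟨ sym (coeff-forms σ w) ⟩
      coeff w (ΠₚL (map form σ)) ∎

    S-expansion : ∀ w → ∑ (λ js → weight js * coeff w (S m (monomial js))) (allFuns m n) ≈ coeff w (S m form)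
    S-expansion w = begin
      ∑ (λ js → weight js * coeff w (S m (monomial js))) (allFuns m n)
        ≈⟨ ∑-cong (allFuns m n) (λ js → trans (*-cong refl (coeff-S m (monomial js) w))
             (trans (sym (∑-*ˡ _ (weight js) (Perms m))) (∑-cong (Perms m) (λ σ → *-leftSwap _ _ _)))) ⟩
      ∑ (λ js → ∑ (λ σ → sgn σ * (weight js * term js σ)) (Perms m)) (allFuns m n)
        ≈⟨ ∑-swap (λ js σ → sgn σ * (weight js * term js σ)) (allFuns m n) (Perms m) ⟩
      ∑ (λ σ → ∑ (λ js → sgn σ * (weight js * term js σ)) (allFuns m n)) (Perms m)
        ≈⟨ ∑-congᴬ (All.map (λ {σ} enum → trans (∑-*ˡ _ (sgn σ) (allFuns m n))
                                                 (*-cong refl (product-expansion σ enum w)))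
                            (Perms-enumerate m)) ⟩
      ∑ (λ σ → sgn σ * coeff w (ΠₚL (map form σ))) (Perms m)
        ≈⟨ sym (coeff-S m form w) ⟩
      coeff w (S m form) ∎
      where
      term : (Fin m → Fin n) → List (Fin m) → Carrier
      term js σ = coeff w (ΠₚL (map (monomial js) σ))

  combination-InIdeal : ∀ {k} (g : Fin k → Poly) (c : Fin k → Carrier) {f} →
                        (∀ w → coeff w f ≈ ∑ (λ l → c l * coeff w (g l)) (allFin k)) → InIdeal g f
  combination-InIdeal {k} g c coeffs = terms , λ w → trans (coeffs w) (sym (combination w))
    where
    terms : List (Poly × Fin k × Poly)
    terms = map (λ l → (constₚ (c l) , l , 1ₚ)) (allFin k)
    combination : ∀ w → coeff w (ΣₚL (map _ terms)) ≈ ∑ (λ l → c l * coeff w (g l)) (allFin k)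
    combination w = trans (coeff-ΣₚL w _ terms)
      (trans (reflexive (∑-map _ _ (allFin k)))
             (∑-cong (allFin k) (λ l → trans (coeff-*1ₚ w (constₚ (c l) *ₚ g l))
                                             (coeff-const* w (c l) (g l)))))

  coeff-tensorPolys : ∀ d n (A : Tensor n (suc (2 ℕ.* d))) j₀ w →
    coeff w (tensorPolys d n A j₀)
      ≈ ∑ (λ js → A (cons j₀ js) * coeff w (S (2 ℕ.* d) (λ t → var (toℕ (js t))))) (allFuns (2 ℕ.* d) n)
  coeff-tensorPolys d n A j₀ w =
    trans (coeff-ΣₚL w _ (allFuns (2 ℕ.* d) n))
          (∑-cong (allFuns (2 ℕ.* d) n)
                  (λ js → coeff-·ₚ w (A (cons j₀ js)) (S (2 ℕ.* d) (λ t → var (toℕ (js t))))))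

  module FromRankDecomposition {n d k : ℕ} (A : Tensor n (suc (2 ℕ.* d))) (rank : Rank≤ A k) where

    m : ℕ
    m = 2 ℕ.* d

    simple : ∀ l → IsSimple (proj₁ rank l)
    simple = proj₁ (proj₂ rank)

    decomposition : ∀ i → A i ≈ ΣF k (λ l → proj₁ rank l i)
    decomposition = proj₂ (proj₂ rank)

    a : Fin k → Fin (suc m) → Fin n → Carrier
    a l = proj₁ (simple l)

    module M (l : Fin k) = Multilinear (λ t → a l (Fin.suc t))

    generator : Fin k → Poly
    generator l = S m (M.form l)

    generator-instance : ∀ l → IsSubstInstance d (generator l)
    generator-instance l = M.form l , λ w → refl

    coefficient : Fin n → Fin k → Carrier
    coefficient j₀ l = a l Fin.zero j₀

    rank-expansion : ∀ j₀ js → A (cons j₀ js) ≈ ∑ (λ l → coefficient j₀ l * M.weight l js) (allFin k)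
    rank-expansion j₀ js =
      trans (decomposition (cons j₀ js))
            (trans (reflexive (P.sym (∑-tabulate k _ (λ l → l))))
                   (∑-cong (allFin k) (λ l → proj₂ (simple l) (cons j₀ js))))

    tensorPoly-coefficients : ∀ j₀ w →
      coeff w (tensorPolys d n A j₀) ≈ ∑ (λ l → coefficient j₀ l * coeff w (generator l)) (allFin k)
    tensorPoly-coefficients j₀ w = begin
      coeff w (tensorPolys d n A j₀)
        ≈⟨ coeff-tensorPolys d n A j₀ w ⟩
      ∑ (λ js → A (cons j₀ js) * s js) (allFuns m n)
        ≈⟨ ∑-cong (allFuns m n) (λ js → *-cong (rank-expansion j₀ js) refl) ⟩
      ∑ (λ js → ∑ (λ l → coefficient j₀ l * M.weight l js) (allFin k) * s js) (allFuns m n)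
        ≈⟨ ∑-bilinear (coefficient j₀) M.weight s (allFuns m n) (allFin k) ⟩
      ∑ (λ l → coefficient j₀ l * ∑ (λ js → M.weight l js * s js) (allFuns m n)) (allFin k)
        ≈⟨ ∑-cong (allFin k) (λ l → *-cong refl (M.S-expansion l w)) ⟩
      ∑ (λ l → coefficient j₀ l * coeff w (generator l)) (allFin k) ∎
      where
      s : (Fin m → Fin n) → Carrier
      s js = coeff w (S m (λ t → var (toℕ (js t))))

    tensorPoly-InIdeal : ∀ j₀ → InIdeal generator (tensorPolys d n A j₀)
    tensorPoly-InIdeal j₀ =
      combination-InIdeal generator (coefficient j₀) {tensorPolys d n A j₀} (tensorPoly-coefficients j₀)

-- The statement uses multiplication on ℕ; it is imported only here, since inside
-- Proof the name _*_ denotes multiplication in the field.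
open import Data.Nat using (_*_)

mainTheorem14 : {c ℓ : Level} (F : Field c ℓ) → FieldTheory.CharZero F → (n d : ℕ) → (A : FieldTheory.Tensor F n (suc (2 * d))) → (k : ℕ) → FieldTheory.Rank≤ F A k → FieldTheory.Q≤ F d (FieldTheory.tensorPolys F d n A) k
mainTheorem14 F _ n d A k rank = generator , generator-instance , tensorPoly-InIdeal
  where
  open Proof.FromRankDecomposition F {d = d} A rank
    using (generator; generator-instance; tensorPoly-InIdeal)
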